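{- Let $t\geq 3$ and $n\geq 2$ be integers with $(t,n)\neq(3,2)$. Then there exists a balanced $t$-coloring of $C_t^n$ that contains no rainbow geometric line.
   Context: For positive integers $t,n$, $C_t^n=\{x_1x_2\cdots x_n : x_i\in\{0,1,\dots,t-1\}\}$ is the set of ordered $n$-tuples over the alphabet $\{0,\dots,t-1\}$. A geometric line in $C_t^n$ is a sequence of $t$ distinct points $\mathbf{x}_0,\mathbf{x}_1,\dots,\mathbf{x}_{t-1}$, $\mathbf{x}_i=x_{i1}x_{i2}\cdots x_{in}$, such that for each coordinate $j\in\{1,\dots,n\}$ one of the following holds: (1) $x_{0j}=x_{1j}=\cdots=x_{t-1,j}$; (2) $x_{ij}=i$ for every $0\le i\le t-1$; (3) $x_{ij}=t-1-i$ for every $0\le i\le t-1$. A $k$-coloring of $C_t^n$ is a surjective map $f:C_t^n\to\{0,\dots,k-1\}$; it is balanced if all color classes $f^{ -1}(s)$ have the same cardinality. A geometric line is rainbow if its $t$ points receive pairwise distinct colors. -}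

module Defs where

open import Data.Nat using (ℕ)
open import Data.Fin using (Fin; opposite)
open import Data.Vec using (Vec; map)
open import Data.Product using (Σ; ∃; _,_)
open import Function.Bundles using (_↔_)
open import Function.Definitions using (Injective; Surjective)
open import Relation.Binary.PropositionalEquality using (_≡_)

Point : ℕ → ℕ → Set
Point t n = Vec (Fin t) n

-- the behaviour of one coordinate along a geometric line
data CoordKind (t : ℕ) : Set where
  const : Fin t → CoordKind t
  inc   : CoordKind t
  dec   : CoordKind t

coordAt : ∀ {t} → CoordKind t → Fin t → Fin t
coordAt (const c) i = c
coordAt inc       i = i
coordAt dec       i = opposite i

linePoints : ∀ {t n} → Vec (CoordKind t) n → Fin t → Point t n
linePoints ks i = map (λ k → coordAt k i) ks

record GeometricLine (t n : ℕ) : Set where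
  constructor mkLine
  field
    kinds    : Vec (CoordKind t) n
    distinct : Injective _≡_ _≡_ (linePoints kinds)

IsColoring : ∀ {t n} (k : ℕ) → (Point t n → Fin k) → Set
IsColoring k f = Surjective _≡_ _≡_ f

ColorClass : ∀ {t n k} → (Point t n → Fin k) → Fin k → Set
ColorClass {t} {n} f s = Σ (Point t n) (λ x → f x ≡ s)

IsBalanced : ∀ {t n k} → (Point t n → Fin k) → Set
IsBalanced {k = k} f = ∃ λ (m : ℕ) → (s : Fin k) → ColorClass f s ↔ Fin m

IsRainbow : ∀ {t n k} → (Point t n → Fin k) → GeometricLine t n → Set
IsRainbow f L = Injective _≡_ _≡_ (λ i → f (linePoints (GeometricLine.kinds L) i))

{-# OPTIONS --safe #-}
module Submission where

-- Color a point of C_t^n by a coloring g of its first d coordinates (d = 2 for t ≥ 4,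
-- d = 3 for t = 3). Every geometric line of C_t^n restricts on those coordinates to a
-- pattern of C_t^d (possibly a constant one), so the coloring has no rainbow line as
-- soon as every pattern of C_t^d repeats a color under g; and each color class is a
-- color class of g times C_t^(n-d), so balance is inherited from g.
-- For t ≥ 4, g is the first coordinate of a permutation of C_t^2, which makes it balanced.
-- For t = 3 no suitable coloring of C_3^2 exists, and g is an explicit coloring of C_3^3
-- whose properties are checked by evaluation.

open import Defs
open import Axiom.UniquenessOfIdentityProofs using (module Decidable⇒UIP)
open import Data.Bool using (Bool; true; false; if_then_else_; _xor_)
open import Data.Empty using (⊥-elim)
open import Data.Fin using (Fin; suc; opposite; _≟_)
open import Data.Fin.Patterns using (0F; 1F; 2F; 3F)
open import Data.Fin.Permutation using (Permutation′; transpose; _∘ₚ_; _⟨$⟩ʳ_)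
open import Data.Fin.Properties using (any?; all?; *↔×; opposite-involutive)
open import Data.Nat using (ℕ; zero; suc; _+_; _*_; _^_; _≤_; s≤s)
open import Data.Product using (Σ; ∃₂; _×_; _,_; proj₁; proj₂)
open import Data.Product.Function.Dependent.Propositional using (Σ-↔)
open import Data.Product.Function.NonDependent.Propositional using (_×-↔_)
open import Data.Product.Properties using (Σ-≡,≡→≡)
open import Data.Vec using (Vec; []; _∷_; _++_; map; take; drop; replicate)
open import Data.Vec.Properties using (take-map; take++drop≡id; map-∘; map-cong)
import Data.Vec.Recursive as Tuple
open import Data.Vec.Recursive.Properties using (↔Vec)
open import Function using (_∘_; id)
open import Function.Bundles using (_↔_; mk↔ₛ′; Inverse)
open import Function.Properties.Inverse using (↔-refl; ↔-sym; ↔-trans)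
open import Level using (0ℓ)
open import Relation.Binary.PropositionalEquality
open import Relation.Nullary using (¬_; Dec; yes; no; does; ¬?; _×-dec_)
open import Relation.Nullary.Decidable using (map′; from-yes)
open import Relation.Unary using (Pred; Decidable; Irrelevant)

open Inverse using (to; from; strictlyInverseˡ; strictlyInverseʳ)

record Collapses {t d k} (g : Point t d → Fin k) (ks : Vec (CoordKind t) d) : Set where
  constructor collapse
  field
    {i j}     : Fin t
    distinct  : i ≢ j
    sameColor : g (linePoints ks i) ≡ g (linePoints ks j)

collapses? : ∀ {t d k} (g : Point t d → Fin k) ks → Dec (Collapses g ks)
collapses? g ks =
  map′ (λ (_ , _ , i≢j , same) → collapse i≢j same) (λ (collapse i≢j same) → _ , _ , i≢j , same)
    (any? λ i → any? λ j → ¬? (i ≟ j) ×-dec (g (linePoints ks i) ≟ g (linePoints ks j)))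

∀-kind? : ∀ {t p} {P : CoordKind t → Set p} → (∀ k → Dec (P k)) → Dec (∀ k → P k)
∀-kind? P? = map′ (λ (p-inc , p-dec , p-const) → λ { inc → p-inc ; dec → p-dec ; (const c) → p-const c })
  (λ ∀P → ∀P inc , ∀P dec , ∀P ∘ const) (P? inc ×-dec P? dec ×-dec all? (P? ∘ const))

∀-pattern? : ∀ {t} d {P : Vec (CoordKind t) d → Set} → (∀ ks → Dec (P ks)) → Dec (∀ ks → P ks)
∀-pattern? zero    P? = map′ (λ p → λ { [] → p }) (λ ∀P → ∀P []) (P? [])
∀-pattern? (suc d) P? = map′ (λ ∀P → λ { (k ∷ ks) → ∀P k ks }) (λ ∀P k ks → ∀P (k ∷ ks))
  (∀-kind? λ k → ∀-pattern? d (P? ∘ (k ∷_)))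

flipKind : ∀ {t} → CoordKind t → CoordKind t
flipKind (const c) = const c
flipKind inc       = dec
flipKind dec       = inc

coordAt-flipKind : ∀ {t} (k : CoordKind t) i → coordAt (flipKind k) i ≡ coordAt k (opposite i)
coordAt-flipKind (const c) i = refl
coordAt-flipKind inc       i = refl
coordAt-flipKind dec       i = sym (opposite-involutive i)

linePoints-flipKind : ∀ {t d} (ks : Vec (CoordKind t) d) i →
                      linePoints (map flipKind ks) i ≡ linePoints ks (opposite i)
linePoints-flipKind ks i =
  trans (sym (map-∘ (λ k → coordAt k i) flipKind ks)) (map-cong (λ k → coordAt-flipKind k i) ks)

opposite-injective : ∀ {n} {i j : Fin n} → opposite i ≡ opposite j → i ≡ j
opposite-injective {i = i} {j} eq =
  trans (sym (opposite-involutive i)) (trans (cong opposite eq) (opposite-involutive j))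

collapses-from-flipKind : ∀ {t d k} {g : Point t d → Fin k} {ks} →
                          Collapses g (map flipKind ks) → Collapses g ks
collapses-from-flipKind {g = g} {ks} (collapse {i} {j} i≢j same) =
  collapse (i≢j ∘ opposite-injective) (begin
    g (linePoints ks (opposite i))     ≡⟨ cong g (linePoints-flipKind ks i) ⟨
    g (linePoints (map flipKind ks) i) ≡⟨ same ⟩
    g (linePoints (map flipKind ks) j) ≡⟨ cong g (linePoints-flipKind ks j) ⟩
    g (linePoints ks (opposite j))     ∎)
  where open ≡-Reasoning

take-++ : ∀ {A : Set} {d m} (xs : Vec A d) (ys : Vec A m) → take d (xs ++ ys) ≡ xs
take-++ []       ys = refl
take-++ (x ∷ xs) ys = cong (x ∷_) (take-++ xs ys)

drop-++ : ∀ {A : Set} {d m} (xs : Vec A d) (ys : Vec A m) → drop d (xs ++ ys) ≡ ys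
drop-++ []       ys = refl
drop-++ (x ∷ xs) ys = drop-++ xs ys

splitAt-↔ : ∀ {A : Set} d {m} → Vec A (d + m) ↔ (Vec A d × Vec A m)
splitAt-↔ d = mk↔ₛ′ (λ xs → take d xs , drop d xs) (λ (xs , ys) → xs ++ ys)
  (λ (xs , ys) → cong₂ _,_ (take-++ xs ys) (drop-++ xs ys)) (take++drop≡id d)

Point↔Fin : ∀ t d → Point t d ↔ Fin (t ^ d)
Point↔Fin t d = ↔-trans (↔-sym (↔Vec d)) (↔-sym (Tuple.Fin[m^n]↔Fin[m]^n t d))

onPrefix : ∀ {t k} d {m} → (Point t d → Fin k) → Point t (d + m) → Fin k
onPrefix d g = g ∘ take d

ColorClass-onPrefix : ∀ {t k} d {m} (g : Point t d → Fin k) s →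
                      ColorClass (onPrefix d {m} g) s ↔ (ColorClass g s × Point t m)
ColorClass-onPrefix d g s = ↔-trans (Σ-↔ (splitAt-↔ d) ↔-refl)
  (mk↔ₛ′ (λ ((x , y) , p) → (x , p) , y) (λ ((x , p) , y) → (x , y) , p) (λ _ → refl) (λ _ → refl))

onPrefix-balanced : ∀ {t k c} d {m} (g : Point t d → Fin k) →
                    (∀ s → ColorClass g s ↔ Fin c) → IsBalanced (onPrefix d {m} g)
onPrefix-balanced {t} {c = c} d {m} g classes = c * t ^ m , λ s →
  ↔-trans (ColorClass-onPrefix d g s) (↔-trans (classes s ×-↔ Point↔Fin t m) (↔-sym (*↔× {c})))

inhabitedClasses⇒IsColoring : ∀ {t n k} {f : Point t n → Fin k} → (∀ s → ColorClass f s) → IsColoring k f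
inhabitedClasses⇒IsColoring inhabited s = proj₁ (inhabited s) , λ { refl → proj₂ (inhabited s) }

onPrefix-coloring : ∀ {t} d {m} (g : Point t d → Fin t) →
                    (∀ s → ColorClass g s) → IsColoring t (onPrefix d {m} g)
onPrefix-coloring d {m} g inhabited = inhabitedClasses⇒IsColoring λ s →
  from (ColorClass-onPrefix d g s) (inhabited s , replicate m s)

take-linePoints : ∀ {t} d {m} (ks : Vec (CoordKind t) (d + m)) i →
                  take d (linePoints ks i) ≡ linePoints (take d ks) i
take-linePoints d ks i = take-map (λ k → coordAt k i) d ks

onPrefix-rainbowFree : ∀ {t k} d {m} (g : Point t d → Fin k) → (∀ ks → Collapses g ks) →
                       (L : GeometricLine t (d + m)) → ¬ IsRainbow (onPrefix d g) L
onPrefix-rainbowFree d g collapses (mkLine ks _) rainbow =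
  let collapse {i} {j} i≢j same = collapses (take d ks) in
  i≢j (rainbow (begin
    g (take d (linePoints ks i)) ≡⟨ cong g (take-linePoints d ks i) ⟩
    g (linePoints (take d ks) i) ≡⟨ same ⟩
    g (linePoints (take d ks) j) ≡⟨ cong g (take-linePoints d ks j) ⟨
    g (take d (linePoints ks j)) ∎))
  where open ≡-Reasoning

RainbowFreeBalancedColoring : ℕ → ℕ → Set
RainbowFreeBalancedColoring t n = Σ (Point t n → Fin t) λ f →
  IsColoring t f × IsBalanced f × ((L : GeometricLine t n) → ¬ IsRainbow f L)

rainbowFreeBalanced-onPrefix : ∀ {t d c} m (g : Point t d → Fin t) →
  (∀ s → ColorClass g s ↔ Fin (suc c)) → (∀ ks → Collapses g ks) →
  RainbowFreeBalancedColoring t (d + m)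
rainbowFreeBalanced-onPrefix {d = d} m g classes collapses =
  onPrefix d g , onPrefix-coloring d g (λ s → from (classes s) 0F) ,
  onPrefix-balanced d g classes , onPrefix-rainbowFree d g collapses

ColorClass-proj₁-↔ : ∀ {t n k} {B : Set} (π : Point t n ↔ (Fin k × B)) s →
                     ColorClass (proj₁ ∘ to π) s ↔ B
ColorClass-proj₁-↔ π s = mk↔ₛ′ (λ (x , _) → proj₂ (to π x))
  (λ b → from π (s , b) , cong proj₁ (strictlyInverseˡ π (s , b)))
  (λ b → cong proj₂ (strictlyInverseˡ π (s , b)))
  λ { (x , refl) → Σ-≡,≡→≡ (strictlyInverseʳ π x , Decidable⇒UIP.≡-irrelevant _≟_ _ _) }

count : ∀ {n p} {P : Pred (Fin n) p} → Decidable P → ℕ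
count {zero}  P? = 0
count {suc n} P? = (if does (P? 0F) then suc else id) (count (P? ∘ suc))

Σ-↔-count : ∀ {n} {P : Pred (Fin n) 0ℓ} (P? : Decidable P) → Irrelevant P →
            Σ (Fin n) P ↔ Fin (count P?)
Σ-↔-count {zero}      P? _   = mk↔ₛ′ (λ ()) (λ ()) (λ ()) (λ ())
Σ-↔-count {suc n} {P} P? irr = cons (P? 0F) (Σ-↔-count (P? ∘ suc) irr)
  where
  sucΣ : Σ (Fin n) (P ∘ suc) → Σ (Fin (suc n)) P
  sucΣ (i , q) = suc i , q

  cons : ∀ {c} (p? : Dec (P 0F)) → Σ (Fin n) (P ∘ suc) ↔ Fin c →
         Σ (Fin (suc n)) P ↔ Fin ((if does p? then suc else id) c)
  cons (yes p) rest = mk↔ₛ′ to′ from′ to∘from from∘to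
    where
    to′ : Σ (Fin (suc n)) P → Fin _
    to′ (0F    , _) = 0F
    to′ (suc i , q) = suc (to rest (i , q))
    from′ : Fin _ → Σ (Fin (suc n)) P
    from′ 0F      = 0F , p
    from′ (suc j) = sucΣ (from rest j)
    to∘from : ∀ j → to′ (from′ j) ≡ j
    to∘from 0F      = refl
    to∘from (suc j) = cong suc (strictlyInverseˡ rest j)
    from∘to : ∀ x → from′ (to′ x) ≡ x
    from∘to (0F    , q) = cong (0F ,_) (irr p q)
    from∘to (suc i , q) = cong sucΣ (strictlyInverseʳ rest (i , q))
  cons (no ¬p) rest = mk↔ₛ′ to′ (sucΣ ∘ from rest) (strictlyInverseˡ rest) from∘to
    where
    to′ : Σ (Fin (suc n)) P → Fin _
    to′ (0F    , q) = ⊥-elim (¬p q)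
    to′ (suc i , q) = to rest (i , q)
    from∘to : ∀ x → sucΣ (from rest (to′ x)) ≡ x
    from∘to (0F    , q) = ⊥-elim (¬p q)
    from∘to (suc i , q) = cong sucΣ (strictlyInverseʳ rest (i , q))

colorCount : ∀ {t d k} → (Point t d → Fin k) → Fin k → ℕ
colorCount {t} {d} g s = count λ i → g (from (Point↔Fin t d) i) ≟ s

ColorClass-↔-colorCount : ∀ {t d k} (g : Point t d → Fin k) s → ColorClass g s ↔ Fin (colorCount g s)
ColorClass-↔-colorCount {t} {d} g s = ↔-trans (↔-sym (Σ-↔ (↔-sym (Point↔Fin t d)) ↔-refl))
  (Σ-↔-count (λ i → g (from (Point↔Fin t d) i) ≟ s) (Decidable⇒UIP.≡-irrelevant _≟_))

isLow : ∀ {n} → Fin n → Bool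
isLow 0F = true
isLow 1F = true
isLow _  = false

swapIfSplit : ∀ {n} → Fin n × Fin n → Fin n × Fin n
swapIfSplit (a , b) = if isLow a xor isLow b then (b , a) else (a , b)

swapIfSplit-involutive : ∀ {n} (p : Fin n × Fin n) → swapIfSplit (swapIfSplit p) ≡ p
swapIfSplit-involutive (a , b) with isLow a in a-low | isLow b in b-low
... | true  | true  rewrite a-low | b-low = refl
... | true  | false rewrite a-low | b-low = refl
... | false | true  rewrite a-low | b-low = refl
... | false | false rewrite a-low | b-low = refl

swapIfSplit-↔ : ∀ {n} → (Fin n × Fin n) ↔ (Fin n × Fin n)
swapIfSplit-↔ = mk↔ₛ′ swapIfSplit swapIfSplit swapIfSplit-involutive swapIfSplit-involutive

cycle023 : ∀ {k} → Permutation′ (4 + k)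
cycle023 = transpose 0F 2F ∘ₚ transpose 0F 3F

-- Rows and columns repeat a color because both sides of the split {0,1} | {2,…,t-1} have
-- at least two elements; cycle023 is only there to make the two diagonals repeat a color.
permutation₂ : ∀ {k} → Point (4 + k) 2 ↔ (Fin (4 + k) × Fin (4 + k))
permutation₂ = ↔-trans (↔-sym (↔Vec 2)) (↔-trans (↔-refl ×-↔ cycle023) swapIfSplit-↔)

coloring₂ : ∀ {k} → Point (4 + k) 2 → Fin (4 + k)
coloring₂ = proj₁ ∘ to permutation₂

coloring₂-classes : ∀ {k} (s : Fin (4 + k)) → ColorClass coloring₂ s ↔ Fin (4 + k)
coloring₂-classes = ColorClass-proj₁-↔ permutation₂

row-collapses : ∀ {k} (a : Fin (4 + k)) → Collapses coloring₂ (const a ∷ inc ∷ [])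
row-collapses 0F            = collapse {i = 1F} {3F} (λ ()) refl
row-collapses 1F            = collapse {i = 1F} {3F} (λ ()) refl
row-collapses (suc (suc a)) = collapse {i = 0F} {2F} (λ ()) refl

column-collapses : ∀ {k} (b : Fin (4 + k)) → Collapses coloring₂ (inc ∷ const b ∷ [])
column-collapses b =
  let i , j , i≢j , same = swapIfSplit-column (cycle023 ⟨$⟩ʳ b) in collapse i≢j same
  where
  swapIfSplit-column : ∀ {k} (c : Fin (4 + k)) →
    ∃₂ λ i j → i ≢ j × proj₁ (swapIfSplit (i , c)) ≡ proj₁ (swapIfSplit (j , c))
  swapIfSplit-column 0F            = 2F , 3F , (λ ()) , refl
  swapIfSplit-column 1F            = 2F , 3F , (λ ()) , refl
  swapIfSplit-column (suc (suc c)) = 0F , 1F , (λ ()) , refl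

antidiagonal-collapses : ∀ {k} → Collapses (coloring₂ {k}) (inc ∷ dec ∷ [])
antidiagonal-collapses {zero}  = collapse {i = 1F} {3F} (λ ()) refl
antidiagonal-collapses {suc k} = collapse {i = 0F} {opposite 0F} (λ ())
  (sym (cong (λ x → proj₁ (swapIfSplit (opposite 0F , cycle023 ⟨$⟩ʳ x))) (opposite-involutive 0F)))

coloring₂-collapses : ∀ {k} (ks : Vec (CoordKind (4 + k)) 2) → Collapses coloring₂ ks
coloring₂-collapses (const a ∷ const b ∷ []) = collapse {i = 0F} {1F} (λ ()) refl
coloring₂-collapses (const a ∷ inc     ∷ []) = row-collapses a
coloring₂-collapses (const a ∷ dec     ∷ []) = collapses-from-flipKind (row-collapses a)
coloring₂-collapses (inc     ∷ const b ∷ []) = column-collapses b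
coloring₂-collapses (dec     ∷ const b ∷ []) = collapses-from-flipKind (column-collapses b)
coloring₂-collapses (inc     ∷ inc     ∷ []) = collapse {i = 0F} {2F} (λ ()) refl
coloring₂-collapses (dec     ∷ dec     ∷ []) = collapses-from-flipKind (coloring₂-collapses (inc ∷ inc ∷ []))
coloring₂-collapses (inc     ∷ dec     ∷ []) = antidiagonal-collapses
coloring₂-collapses (dec     ∷ inc     ∷ []) = collapses-from-flipKind antidiagonal-collapses

coloring₃ : Point 3 3 → Fin 3
coloring₃ (a ∷ b ∷ c ∷ []) = Tuple.lookup (Tuple.lookup (Tuple.lookup table a) b) c
  where
  table : ((Fin 3 Tuple.^ 3) Tuple.^ 3) Tuple.^ 3
  table = ((1F , 2F , 1F) , (1F , 2F , 2F) , (1F , 2F , 2F))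
        , ((1F , 1F , 0F) , (1F , 0F , 0F) , (0F , 0F , 1F))
        , ((2F , 2F , 0F) , (2F , 2F , 0F) , (0F , 0F , 1F))

coloring₃-classes : ∀ s → ColorClass coloring₃ s ↔ Fin 9
coloring₃-classes 0F = ColorClass-↔-colorCount coloring₃ 0F
coloring₃-classes 1F = ColorClass-↔-colorCount coloring₃ 1F
coloring₃-classes 2F = ColorClass-↔-colorCount coloring₃ 2F

coloring₃-collapses : ∀ ks → Collapses coloring₃ ks
coloring₃-collapses = from-yes (∀-pattern? 3 (collapses? coloring₃))

theorem2 : (t n : ℕ) → 3 ≤ t → 2 ≤ n → ¬ (t ≡ 3 × n ≡ 2) →
    Σ (Point t n → Fin t) (λ f →
      IsColoring t f × IsBalanced f × ((L : GeometricLine t n) → ¬ IsRainbow f L))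
theorem2 3 2 _ _ not-3-2 = ⊥-elim (not-3-2 (refl , refl))
theorem2 3 (suc (suc (suc m))) _ _ _ =
  rainbowFreeBalanced-onPrefix m coloring₃ coloring₃-classes coloring₃-collapses
theorem2 (suc (suc (suc (suc k)))) (suc (suc m)) _ _ _ =
  rainbowFreeBalanced-onPrefix m coloring₂ coloring₂-classes coloring₂-collapses
theorem2 (suc (suc (suc _))) 1 _ (s≤s ()) _
theorem2 1 _ (s≤s ()) _ _
theorem2 2 _ (s≤s (s≤s ())) _ _
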